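{- For $k\ge2$ and $|q|<1$, \[ \sum_{n_1,n_2,\dotsc,n_k \geq 0} \frac{q^{n_1+n_2+\dotsb+n_k+n_1n_2+n_2n_3+\dotsb+n_{k-1}n_k}} {(q)_{n_1} (q)_{n_2}^{2} (q)_{n_3}^{2} \dotsm (q)_{n_{k-1}}^2 (q)_{n_k}} = \frac{1}{(1-q)(q)_\infty^{k-1}}. \]
   Context: $(q)_n=\prod_{i=1}^{n}(1-q^i)$ and $(q)_\infty=\prod_{i\ge1}(1-q^i)$. For $k=2$ the denominator on the left is $(q)_{n_1}(q)_{n_2}$. -}

module Defs where

open import Data.Nat as ℕ using (ℕ; zero; suc; _∸_; _≤ᵇ_)
open import Data.Integer as ℤ using (ℤ; 0ℤ; 1ℤ; _+_; _*_; -_; _-_)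
open import Data.List using (List; []; _∷_; map; foldr; upTo; zipWith; concatMap)
open import Data.Bool using (if_then_else_)

-- A formal power series: n ↦ coefficient of q^n.
PS : Set
PS = ℕ → ℤ

sumℤ : List ℤ → ℤ
sumℤ = foldr _+_ 0ℤ

sumℕ : List ℕ → ℕ
sumℕ = foldr ℕ._+_ 0

onePS : PS
onePS zero    = 1ℤ
onePS (suc _) = 0ℤ

mono : ℕ → PS
mono e n = if (e ≤ᵇ n) ∧' (n ≤ᵇ e) then 1ℤ else 0ℤ
  where
  open import Data.Bool renaming (_∧_ to _∧'_)

subPS : PS → PS → PS
subPS f g n = f n - g n

mulPS : PS → PS → PS
mulPS f g n = sumℤ (map (λ i → f i * g (n ∸ i)) (upTo (suc n)))

prodPS : List PS → PS
prodPS = foldr mulPS onePS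

powPS : PS → ℕ → PS
powPS f zero    = onePS
powPS f (suc m) = mulPS f (powPS f m)

shift : ℕ → PS → PS
shift e f n = if e ≤ᵇ n then f (n ∸ e) else 0ℤ

-- Multiplicative inverse of a power series with constant term 1:
-- b₀ = 1,  b_{n+1} = - Σ_{i=1}^{n+1} f_i b_{n+1-i}.
-- invRev f n = [b_n , b_{n-1} , … , b_0].
invRev : PS → ℕ → List ℤ
invRev f zero    = 1ℤ ∷ []
invRev f (suc n) =
  (- sumℤ (zipWith _*_ (map (λ j → f (suc j)) (upTo (suc n))) (invRev f n)))
  ∷ invRev f n

headℤ : List ℤ → ℤ
headℤ []      = 0ℤ
headℤ (x ∷ _) = x

inv : PS → PS
inv f n = headℤ (invRev f n)

poch : ℕ → PS
poch zero    = onePS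
poch (suc n) = mulPS (poch n) (subPS onePS (mono (suc n)))

-- (q)_∞ = ∏_{i≥1} (1 - q^i): its q^N coefficient is that of (q)_N
-- (the factors with i > N do not affect coefficients of degree ≤ N).
qinf : PS
qinf N = poch N N

adjSum : List ℕ → ℕ
adjSum (a ∷ b ∷ r) = a ℕ.* b ℕ.+ adjSum (b ∷ r)
adjSum _           = 0

exponent : List ℕ → ℕ
exponent ns = sumℕ ns ℕ.+ adjSum ns

denomFactors : List ℕ → List PS
denomFactors []      = []
denomFactors (a ∷ r) = poch a ∷ mid r
  where
  mid : List ℕ → List PS
  mid []          = []
  mid (b ∷ [])    = poch b ∷ []
  mid (b ∷ c ∷ s) = poch b ∷ poch b ∷ mid (c ∷ s)

term : List ℕ → PS
term ns = shift (exponent ns) (inv (prodPS (denomFactors ns)))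

tuples : ℕ → ℕ → List (List ℕ)
tuples N zero    = [] ∷ []
tuples N (suc k) = concatMap (λ a → map (a ∷_) (tuples N k)) (upTo (suc N))

-- Since term (n₁,…,n_k) is divisible by
-- q^{n₁+…+n_k}, only tuples with all n_i ≤ N contribute to the q^N
-- coefficient, so this finite sum is the coefficient of the formal sum.
lhs : ℕ → PS
lhs k N = sumℤ (map (λ ns → term ns N) (tuples N k))

rhs : ℕ → PS
rhs k = inv (mulPS (subPS onePS (mono 1)) (powPS qinf (k ∸ 1)))

module Submission where

-- Summing out the first index n₁ = a of a summand with n₂ = b uses
-- Euler's identity  Σ_a q^{a(b+1)} / (q)_a = (q)_b / (q)_∞ .  Since b occurs
-- in the denominator twice when it is an interior index, this gives
--   Σ_a term (a , b , n₃ , …) = term (b , n₃ , …) / (q)_∞ ,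
-- while for k = 2 it gives  Σ_a term (a , b) = q^b / (q)_∞  and then
-- Σ_b q^b = 1 / (1 - q).  Induction on k yields the proposition.

open import Defs
open import Data.Nat using (ℕ; _≤_)
open import Relation.Binary.PropositionalEquality using (_≡_)

open import Data.Nat as ℕ using (zero; suc; _∸_; _<_; z≤n; s≤s)
import Data.Nat.Properties as ℕP
import Data.Nat.Tactic.RingSolver as ℕSolver
open import Data.Integer using (ℤ; 0ℤ; 1ℤ; _+_; _*_; -_; _-_)
import Data.Integer.Properties as ℤP
open import Data.Integer.Tactic.RingSolver using (solve-∀)
open import Data.List using (List; []; _∷_; map; upTo; applyUpTo; zipWith; concatMap; _++_)
open import Data.List.Properties using (map-cong; map-∘)
open import Function using (_∘_; id)
open import Relation.Binary.PropositionalEquality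
  using (refl; sym; trans; cong; cong₂; subst)
open import Relation.Binary.Bundles using (Setoid)
import Relation.Binary.Reasoning.Setoid as SetoidReasoning

sumUpTo : ℕ → (ℕ → ℤ) → ℤ
sumUpTo zero    h = 0ℤ
sumUpTo (suc n) h = h 0 + sumUpTo n (h ∘ suc)

sum-applyUpTo : ∀ (h : ℕ → ℤ) f n → sumℤ (map h (applyUpTo f n)) ≡ sumUpTo n (h ∘ f)
sum-applyUpTo h f zero    = refl
sum-applyUpTo h f (suc n) = cong (h (f 0) +_) (sum-applyUpTo h (f ∘ suc) n)

sumUpTo-cong : ∀ n {h h' : ℕ → ℤ} → (∀ i → h i ≡ h' i) → sumUpTo n h ≡ sumUpTo n h'
sumUpTo-cong zero    eq = refl
sumUpTo-cong (suc n) eq = cong₂ _+_ (eq 0) (sumUpTo-cong n (eq ∘ suc))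

sumUpTo-+ : ∀ n (h h' : ℕ → ℤ) → sumUpTo n (λ i → h i + h' i) ≡ sumUpTo n h + sumUpTo n h'
sumUpTo-+ zero    h h' = refl
sumUpTo-+ (suc n) h h' =
  trans (cong (h 0 + h' 0 +_) (sumUpTo-+ n (h ∘ suc) (h' ∘ suc))) (interchange (h 0) (h' 0) _ _)
  where
  interchange : ∀ a b c d → (a + b) + (c + d) ≡ (a + c) + (b + d)
  interchange = solve-∀

sumUpTo-0 : ∀ n → sumUpTo n (λ _ → 0ℤ) ≡ 0ℤ
sumUpTo-0 zero    = refl
sumUpTo-0 (suc n) = trans (ℤP.+-identityˡ _) (sumUpTo-0 n)

sumUpTo-snoc : ∀ n (h : ℕ → ℤ) → sumUpTo (suc n) h ≡ sumUpTo n h + h n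
sumUpTo-snoc zero    h = trans (ℤP.+-identityʳ (h 0)) (sym (ℤP.+-identityˡ (h 0)))
sumUpTo-snoc (suc n) h =
  trans (cong (h 0 +_) (sumUpTo-snoc n (h ∘ suc))) (sym (ℤP.+-assoc (h 0) _ (h (suc n))))

module _ {A : Set} where

  sumList-cong : ∀ (L : List A) {F G : A → ℤ} → (∀ x → F x ≡ G x) →
                 sumℤ (map F L) ≡ sumℤ (map G L)
  sumList-cong L e = cong sumℤ (map-cong e L)

  sumList-++ : ∀ (h : A → ℤ) xs ys →
               sumℤ (map h (xs ++ ys)) ≡ sumℤ (map h xs) + sumℤ (map h ys)
  sumList-++ h []       ys = sym (ℤP.+-identityˡ _)
  sumList-++ h (x ∷ xs) ys = trans (cong (h x +_) (sumList-++ h xs ys)) (sym (ℤP.+-assoc (h x) _ _))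

  sumList-concatMap : ∀ {B : Set} (h : A → ℤ) (g : B → List A) L →
    sumℤ (map h (concatMap g L)) ≡ sumℤ (map (λ x → sumℤ (map h (g x))) L)
  sumList-concatMap h g []      = refl
  sumList-concatMap h g (x ∷ L) =
    trans (sumList-++ h (g x) (concatMap g L)) (cong (sumℤ (map h (g x)) +_) (sumList-concatMap h g L))

  sumUpTo-sumList : ∀ n (L : List A) (F : ℕ → A → ℤ) →
    sumUpTo n (λ a → sumℤ (map (F a) L)) ≡ sumℤ (map (λ x → sumUpTo n (λ a → F a x)) L)
  sumUpTo-sumList n []      F = sumUpTo-0 n
  sumUpTo-sumList n (x ∷ L) F =
    trans (sumUpTo-+ n (λ a → F a x) (λ a → sumℤ (map (F a) L)))
          (cong (sumUpTo n (λ a → F a x) +_) (sumUpTo-sumList n L F))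

infixl 6 _⊕_
infixl 7 _·_
infix  4 _≐_ _≈[_]_

_·_ : PS → PS → PS
_·_ = mulPS

_⊕_ : PS → PS → PS
(f ⊕ g) n = f n + g n

⊖_ : PS → PS
(⊖ f) n = - f n

𝟘 : PS
𝟘 _ = 0ℤ

_≐_ : PS → PS → Set
f ≐ g = ∀ n → f n ≡ g n

_≈[_]_ : PS → ℕ → PS → Set
f ≈[ M ] g = ∀ j → j ≤ M → f j ≡ g j

≐-setoid : Setoid _ _
≐-setoid = record
  { Carrier       = PS
  ; _≈_           = _≐_
  ; isEquivalence = record
    { refl  = λ _ → refl
    ; sym   = λ e n → sym (e n)
    ; trans = λ e e' n → trans (e n) (e' n) } }

≈-setoid : ℕ → Setoid _ _
≈-setoid M = record
  { Carrier       = PS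
  ; _≈_           = λ f g → f ≈[ M ] g
  ; isEquivalence = record
    { refl  = λ _ _ → refl
    ; sym   = λ e j p → sym (e j p)
    ; trans = λ e e' j p → trans (e j p) (e' j p) } }

exact : ∀ {M f g} → f ≐ g → f ≈[ M ] g
exact e j _ = e j

≈-refl : ∀ {M f} → f ≈[ M ] f
≈-refl _ _ = refl

≈-sym : ∀ {M f g} → f ≈[ M ] g → g ≈[ M ] f
≈-sym e j p = sym (e j p)

≈⇒≐ : ∀ {f g} → (∀ M → f ≈[ M ] g) → f ≐ g
≈⇒≐ e n = e n n ℕP.≤-refl

·-sum : ∀ f g n → (f · g) n ≡ sumUpTo (suc n) (λ i → f i * g (n ∸ i))
·-sum f g n = sum-applyUpTo (λ i → f i * g (n ∸ i)) id (suc n)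

·-at-0 : ∀ f g → (f · g) 0 ≡ f 0 * g 0
·-at-0 f g = trans (·-sum f g 0) (ℤP.+-identityʳ _)

·-at-suc : ∀ f g n → (f · g) (suc n) ≡ f 0 * g (suc n) + ((f ∘ suc) · g) n
·-at-suc f g n = trans (·-sum f g (suc n)) (cong (f 0 * g (suc n) +_) (sym (·-sum (f ∘ suc) g n)))

·-at-sucʳ : ∀ f g n → (f · g) (suc n) ≡ (f · (g ∘ suc)) n + f (suc n) * g 0
·-at-sucʳ f g zero =
  trans (·-at-suc f g 0)
        (trans (cong (f 0 * g 1 +_) (·-at-0 (f ∘ suc) g))
               (cong (_+ f 1 * g 0) (sym (·-at-0 f (g ∘ suc)))))
·-at-sucʳ f g (suc n) =
  trans (·-at-suc f g (suc n))
  (trans (cong (f 0 * g (suc (suc n)) +_) (·-at-sucʳ (f ∘ suc) g n))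
  (trans (sym (ℤP.+-assoc (f 0 * g (suc (suc n))) _ (f (suc (suc n)) * g 0)))
         (cong (_+ f (suc (suc n)) * g 0) (sym (·-at-suc f (g ∘ suc) n)))))

·-local : ∀ n {f f' g g'} → f ≈[ n ] f' → g ≈[ n ] g' → (f · g) n ≡ (f' · g') n
·-local zero {f} {f'} {g} {g'} ef eg =
  trans (·-at-0 f g) (trans (cong₂ _*_ (ef 0 z≤n) (eg 0 z≤n)) (sym (·-at-0 f' g')))
·-local (suc n) {f} {f'} {g} {g'} ef eg =
  trans (·-at-suc f g n)
  (trans (cong₂ _+_ (cong₂ _*_ (ef 0 z≤n) (eg (suc n) ℕP.≤-refl))
                    (·-local n (λ i p → ef (suc i) (s≤s p)) (λ i p → eg i (ℕP.m≤n⇒m≤1+n p))))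
         (sym (·-at-suc f' g' n)))

·-cong : ∀ {M f f' g g'} → f ≈[ M ] f' → g ≈[ M ] g' → f · g ≈[ M ] f' · g'
·-cong ef eg j p = ·-local j (λ i q → ef i (ℕP.≤-trans q p)) (λ i q → eg i (ℕP.≤-trans q p))

·-congˡ : ∀ {M f f'} g → f ≈[ M ] f' → f · g ≈[ M ] f' · g
·-congˡ g ef = ·-cong {g = g} {g' = g} ef ≈-refl

·-congʳ : ∀ {M g g'} f → g ≈[ M ] g' → f · g ≈[ M ] f · g'
·-congʳ f eg = ·-cong {f = f} {f' = f} ≈-refl eg

·-congˡ-≐ : ∀ {f f'} g → f ≐ f' → f · g ≐ f' · g
·-congˡ-≐ g e = ≈⇒≐ (λ M → ·-congˡ g (exact e))

·-congʳ-≐ : ∀ {g g'} f → g ≐ g' → f · g ≐ f · g'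
·-congʳ-≐ f e = ≈⇒≐ (λ M → ·-congʳ f (exact e))

·-comm : ∀ f g → f · g ≐ g · f
·-comm f g zero = trans (·-at-0 f g) (trans (ℤP.*-comm (f 0) (g 0)) (sym (·-at-0 g f)))
·-comm f g (suc n) =
  trans (·-at-suc f g n)
  (trans (cong (f 0 * g (suc n) +_) (·-comm (f ∘ suc) g n))
  (trans (swap (f 0) (g (suc n)) _) (sym (·-at-sucʳ g f n))))
  where
  swap : ∀ a b x → a * b + x ≡ x + b * a
  swap = solve-∀

·-zeroˡ : ∀ g → 𝟘 · g ≐ 𝟘
·-zeroˡ g zero    = trans (·-at-0 𝟘 g) (ℤP.*-zeroˡ (g 0))
·-zeroˡ g (suc n) = trans (·-at-suc 𝟘 g n) (cong₂ _+_ (ℤP.*-zeroˡ (g (suc n))) (·-zeroˡ g n))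

·-zeroʳ : ∀ g → g · 𝟘 ≐ 𝟘
·-zeroʳ g n = trans (·-comm g 𝟘 n) (·-zeroˡ g n)

·-identityˡ : ∀ g → onePS · g ≐ g
·-identityˡ g zero    = trans (·-at-0 onePS g) (ℤP.*-identityˡ (g 0))
·-identityˡ g (suc n) =
  trans (·-at-suc onePS g n)
        (trans (cong₂ _+_ (ℤP.*-identityˡ (g (suc n))) (·-zeroˡ g n)) (ℤP.+-identityʳ _))

·-identityʳ : ∀ g → g · onePS ≐ g
·-identityʳ g n = trans (·-comm g onePS n) (·-identityˡ g n)

·-distribʳ : ∀ f g h → (f ⊕ g) · h ≐ f · h ⊕ g · h
·-distribʳ f g h zero =
  trans (·-at-0 (f ⊕ g) h)
        (trans (ℤP.*-distribʳ-+ (h 0) (f 0) (g 0)) (sym (cong₂ _+_ (·-at-0 f h) (·-at-0 g h))))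
·-distribʳ f g h (suc n) =
  trans (·-at-suc (f ⊕ g) h n)
  (trans (cong ((f 0 + g 0) * h (suc n) +_) (·-distribʳ (f ∘ suc) (g ∘ suc) h n))
  (trans (regroup (f 0) (g 0) (h (suc n)) _ _)
         (sym (cong₂ _+_ (·-at-suc f h n) (·-at-suc g h n)))))
  where
  regroup : ∀ a b c x y → (a + b) * c + (x + y) ≡ (a * c + x) + (b * c + y)
  regroup = solve-∀

·-distribˡ : ∀ f g h → f · (g ⊕ h) ≐ f · g ⊕ f · h
·-distribˡ f g h n =
  trans (·-comm f (g ⊕ h) n)
        (trans (·-distribʳ g h f n) (cong₂ _+_ (·-comm g f n) (·-comm h f n)))

·-negˡ : ∀ f g → (⊖ f) · g ≐ ⊖ (f · g)
·-negˡ f g zero =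
  trans (·-at-0 (⊖ f) g) (trans (sym (ℤP.neg-distribˡ-* (f 0) (g 0))) (cong -_ (sym (·-at-0 f g))))
·-negˡ f g (suc n) =
  trans (·-at-suc (⊖ f) g n)
  (trans (cong (- f 0 * g (suc n) +_) (·-negˡ (f ∘ suc) g n))
  (trans (neg-out (f 0) (g (suc n)) _) (cong -_ (sym (·-at-suc f g n)))))
  where
  neg-out : ∀ a b x → - a * b + - x ≡ - (a * b + x)
  neg-out = solve-∀

·-negʳ : ∀ f g → f · (⊖ g) ≐ ⊖ (f · g)
·-negʳ f g n = trans (·-comm f (⊖ g) n) (trans (·-negˡ g f n) (cong -_ (·-comm g f n)))

·-scaleˡ : ∀ c f g → (λ n → c * f n) · g ≐ (λ n → c * (f · g) n)
·-scaleˡ c f g zero =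
  trans (·-at-0 (λ n → c * f n) g) (trans (ℤP.*-assoc c (f 0) (g 0)) (cong (c *_) (sym (·-at-0 f g))))
·-scaleˡ c f g (suc n) =
  trans (·-at-suc (λ n → c * f n) g n)
  (trans (cong (c * f 0 * g (suc n) +_) (·-scaleˡ c (f ∘ suc) g n))
  (trans (factor c (f 0) (g (suc n)) _) (cong (c *_) (sym (·-at-suc f g n)))))
  where
  factor : ∀ c a b x → c * a * b + c * x ≡ c * (a * b + x)
  factor = solve-∀

·-assoc : ∀ f g h → (f · g) · h ≐ f · (g · h)
·-assoc f g h zero =
  trans (·-at-0 (f · g) h)
  (trans (cong (_* h 0) (·-at-0 f g))
  (trans (ℤP.*-assoc (f 0) (g 0) (h 0))
  (trans (cong (f 0 *_) (sym (·-at-0 g h))) (sym (·-at-0 f (g · h))))))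
·-assoc f g h (suc n) =
  trans (·-at-suc (f · g) h n)
  (trans (cong₂ _+_ (cong (_* h (suc n)) (·-at-0 f g)) tail-of-fg)
  (trans (regroup (f 0) (g 0) (h (suc n)) _ _)
  (trans (cong (λ z → f 0 * z + ((f ∘ suc) · (g · h)) n) (sym (·-at-suc g h n)))
         (sym (·-at-suc f (g · h) n)))))
  where
  -- (f · g) shifted down by one is  f 0 · (g ∘ suc) ⊕ (f ∘ suc) · g.
  tail-of-fg : (((f · g) ∘ suc) · h) n ≡ f 0 * ((g ∘ suc) · h) n + ((f ∘ suc) · (g · h)) n
  tail-of-fg =
    trans (·-congˡ-≐ h (·-at-suc f g) n)
    (trans (·-distribʳ (λ m → f 0 * g (suc m)) ((f ∘ suc) · g) h n)
           (cong₂ _+_ (·-scaleˡ (f 0) (g ∘ suc) h n) (·-assoc (f ∘ suc) g h n)))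
  regroup : ∀ a b c x y → a * b * c + (a * x + y) ≡ a * (b * c + x) + y
  regroup = solve-∀

ConstOne : PS → Set
ConstOne f = f 0 ≡ 1ℤ

·-constOne : ∀ f g → ConstOne f → ConstOne g → ConstOne (f · g)
·-constOne f g f0 g0 = trans (·-at-0 f g) (cong₂ _*_ f0 g0)

sum-zipWith : ∀ (h : ℕ → ℤ) a g m →
  sumℤ (zipWith _*_ (map h (applyUpTo a m)) (applyUpTo g m)) ≡ sumUpTo m (λ i → h (a i) * g i)
sum-zipWith h a g zero    = refl
sum-zipWith h a g (suc m) = cong (h (a 0) * g 0 +_) (sum-zipWith h (a ∘ suc) (g ∘ suc) m)

invRev-table : ∀ f n → invRev f n ≡ applyUpTo (λ i → inv f (n ∸ i)) (suc n)
invRev-table f zero    = refl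
invRev-table f (suc n) = cong (inv f (suc n) ∷_) (invRev-table f n)

inv-at-suc : ∀ f n → inv f (suc n) ≡ - ((f ∘ suc) · inv f) n
inv-at-suc f n = cong -_
  (trans (cong (λ L → sumℤ (zipWith _*_ (map (f ∘ suc) (upTo (suc n))) L)) (invRev-table f n))
  (trans (sum-zipWith (f ∘ suc) id (λ i → inv f (n ∸ i)) (suc n))
         (sym (·-sum (f ∘ suc) (inv f) n))))

inv-inverseʳ : ∀ f → ConstOne f → f · inv f ≐ onePS
inv-inverseʳ f f0 zero    = trans (·-at-0 f (inv f)) (cong (_* 1ℤ) f0)
inv-inverseʳ f f0 (suc n) =
  trans (·-at-suc f (inv f) n)
        (trans (cong (_+ ((f ∘ suc) · inv f) n) (cong₂ _*_ f0 (inv-at-suc f n)))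
               (cancel (((f ∘ suc) · inv f) n)))
  where
  cancel : ∀ x → 1ℤ * - x + x ≡ 0ℤ
  cancel = solve-∀

inv-unique : ∀ {M} f g → ConstOne f → f · g ≈[ M ] onePS → g ≈[ M ] inv f
inv-unique {M} f g f0 fg≈1 = begin
  g                     ≈⟨ exact (λ n → sym (·-identityˡ g n)) ⟩
  onePS · g             ≈⟨ exact (·-congˡ-≐ g (λ n → sym (inv-inverseʳ f f0 n))) ⟩
  (f · inv f) · g       ≈⟨ exact (·-congˡ-≐ g (·-comm f (inv f))) ⟩
  (inv f · f) · g       ≈⟨ exact (·-assoc (inv f) f g) ⟩
  inv f · (f · g)       ≈⟨ ·-congʳ (inv f) fg≈1 ⟩
  inv f · onePS         ≈⟨ exact (·-identityʳ (inv f)) ⟩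
  inv f                 ∎
  where open SetoidReasoning (≈-setoid M)

inv-unique-≐ : ∀ f g → ConstOne f → f · g ≐ onePS → g ≐ inv f
inv-unique-≐ f g f0 e = ≈⇒≐ (λ M → inv-unique f g f0 (exact e))

inv-cong : ∀ {f g} → ConstOne f → f ≐ g → inv f ≐ inv g
inv-cong {f} {g} f0 e = inv-unique-≐ g (inv f) (trans (sym (e 0)) f0)
  (λ n → trans (·-congˡ-≐ (inv f) (λ m → sym (e m)) n) (inv-inverseʳ f f0 n))

inv-· : ∀ f g → ConstOne f → ConstOne g → inv (f · g) ≐ inv f · inv g
inv-· f g f0 g0 n = sym (inv-unique-≐ (f · g) (inv f · inv g) (·-constOne f g f0 g0) product-inverse n)
  where
  product-inverse : (f · g) · (inv f · inv g) ≐ onePS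
  product-inverse = begin
    (f · g) · (inv f · inv g)   ≈⟨ ·-assoc f g (inv f · inv g) ⟩
    f · (g · (inv f · inv g))   ≈⟨ ·-congʳ-≐ f (·-congʳ-≐ g (·-comm (inv f) (inv g))) ⟩
    f · (g · (inv g · inv f))   ≈⟨ ·-congʳ-≐ f (λ k → sym (·-assoc g (inv g) (inv f) k)) ⟩
    f · ((g · inv g) · inv f)   ≈⟨ ·-congʳ-≐ f (·-congˡ-≐ (inv f) (inv-inverseʳ g g0)) ⟩
    f · (onePS · inv f)         ≈⟨ ·-congʳ-≐ f (·-identityˡ (inv f)) ⟩
    f · inv f                   ≈⟨ inv-inverseʳ f f0 ⟩
    onePS                       ∎
    where open SetoidReasoning ≐-setoid

·-inv-cancel : ∀ A B → ConstOne A → ConstOne B → A · inv (A · B) ≐ inv B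
·-inv-cancel A B A0 B0 = begin
  A · inv (A · B)           ≈⟨ ·-congʳ-≐ A (inv-· A B A0 B0) ⟩
  A · (inv A · inv B)       ≈⟨ (λ n → sym (·-assoc A (inv A) (inv B) n)) ⟩
  (A · inv A) · inv B       ≈⟨ ·-congˡ-≐ (inv B) (inv-inverseʳ A A0) ⟩
  onePS · inv B             ≈⟨ ·-identityˡ (inv B) ⟩
  inv B                     ∎
  where open SetoidReasoning ≐-setoid

inv-one : inv onePS ≐ onePS
inv-one n = sym (inv-unique-≐ onePS onePS refl (·-identityˡ onePS) n)

shift-at-suc : ∀ e f n → shift (suc e) f (suc n) ≡ shift e f n
shift-at-suc zero    f n = refl
shift-at-suc (suc e) f n = refl

mono≐shift : ∀ e → mono e ≐ shift e onePS
mono≐shift zero    zero    = refl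
mono≐shift zero    (suc n) = refl
mono≐shift (suc e) zero    = refl
mono≐shift (suc e) (suc n) = trans (mono-at-suc e n) (trans (mono≐shift e n) (sym (shift-at-suc e onePS n)))
  where
  mono-at-suc : ∀ e n → mono (suc e) (suc n) ≡ mono e n
  mono-at-suc zero    zero    = refl
  mono-at-suc zero    (suc n) = refl
  mono-at-suc (suc e) zero    = refl
  mono-at-suc (suc e) (suc n) = refl

shift-+ : ∀ a b f → shift (a ℕ.+ b) f ≐ shift a (shift b f)
shift-+ zero    b f n       = refl
shift-+ (suc a) b f zero    = refl
shift-+ (suc a) b f (suc n) =
  trans (shift-at-suc (a ℕ.+ b) f n) (trans (shift-+ a b f n) (sym (shift-at-suc a (shift b f) n)))

shift-vanish : ∀ e f j → j < e → shift e f j ≡ 0ℤ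
shift-vanish (suc e) f zero    p       = refl
shift-vanish (suc e) f (suc j) (s≤s p) = trans (shift-at-suc e f j) (shift-vanish e f j p)

shift-local : ∀ e {f g} j → f ≈[ j ] g → shift e f j ≡ shift e g j
shift-local zero    j       e = e j ℕP.≤-refl
shift-local (suc e) zero    _ = refl
shift-local (suc e) {f} {g} (suc j) eq =
  trans (shift-at-suc e f j)
        (trans (shift-local e j (λ i p → eq i (ℕP.m≤n⇒m≤1+n p))) (sym (shift-at-suc e g j)))

shift-cong : ∀ e {f g} → f ≐ g → shift e f ≐ shift e g
shift-cong e eq j = shift-local e j (exact eq)

shift-⊕ : ∀ e f g → shift e (f ⊕ g) ≐ shift e f ⊕ shift e g
shift-⊕ zero    f g n       = refl
shift-⊕ (suc e) f g zero    = refl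
shift-⊕ (suc e) f g (suc n) =
  trans (shift-at-suc e (f ⊕ g) n)
        (trans (shift-⊕ e f g n) (sym (cong₂ _+_ (shift-at-suc e f n) (shift-at-suc e g n))))

shift-⊖ : ∀ e f → shift e (⊖ f) ≐ ⊖ shift e f
shift-⊖ zero    f n       = refl
shift-⊖ (suc e) f zero    = refl
shift-⊖ (suc e) f (suc n) =
  trans (shift-at-suc e (⊖ f) n) (trans (shift-⊖ e f n) (sym (cong -_ (shift-at-suc e f n))))

shift-𝟘 : ∀ e → shift e 𝟘 ≐ 𝟘
shift-𝟘 zero    n       = refl
shift-𝟘 (suc e) zero    = refl
shift-𝟘 (suc e) (suc n) = trans (shift-at-suc e 𝟘 n) (shift-𝟘 e n)

·-shiftˡ : ∀ e f g → shift e f · g ≐ shift e (f · g)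
·-shiftˡ zero    f g         = ·-congˡ-≐ {shift 0 f} {f} g (λ _ → refl)
·-shiftˡ (suc e) f g zero    = trans (·-at-0 (shift (suc e) f) g) (ℤP.*-zeroˡ (g 0))
·-shiftˡ (suc e) f g (suc n) =
  trans (·-at-suc (shift (suc e) f) g n)
  (trans (cong₂ _+_ (ℤP.*-zeroˡ (g (suc n))) (·-congˡ-≐ g (shift-at-suc e f) n))
  (trans (ℤP.+-identityˡ _)
  (trans (·-shiftˡ e f g n) (sym (shift-at-suc e (f · g) n)))))

·-shiftʳ : ∀ e f g → f · shift e g ≐ shift e (f · g)
·-shiftʳ e f g n =
  trans (·-comm f (shift e g) n) (trans (·-shiftˡ e g f n) (shift-cong e (·-comm g f) n))

shift-inv-· : ∀ e₁ e₂ A B → ConstOne A → ConstOne B →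
              shift (e₁ ℕ.+ e₂) (inv (A · B)) ≐ shift e₁ (inv A) · shift e₂ (inv B)
shift-inv-· e₁ e₂ A B A0 B0 = begin
  shift (e₁ ℕ.+ e₂) (inv (A · B))          ≈⟨ shift-+ e₁ e₂ (inv (A · B)) ⟩
  shift e₁ (shift e₂ (inv (A · B)))        ≈⟨ shift-cong e₁ (shift-cong e₂ (inv-· A B A0 B0)) ⟩
  shift e₁ (shift e₂ (inv A · inv B))      ≈⟨ shift-cong e₁ (λ m → sym (·-shiftʳ e₂ (inv A) (inv B) m)) ⟩
  shift e₁ (inv A · shift e₂ (inv B))      ≈⟨ (λ m → sym (·-shiftˡ e₁ (inv A) (shift e₂ (inv B)) m)) ⟩
  shift e₁ (inv A) · shift e₂ (inv B)      ∎
  where open SetoidReasoning ≐-setoid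

1-q^ : ℕ → PS
1-q^ e = subPS onePS (mono e)

·-1-q^ : ∀ e f → f · 1-q^ e ≐ f ⊕ ⊖ shift e f
·-1-q^ e f = begin
  f · 1-q^ e                           ≈⟨ ·-congʳ-≐ f (λ m → cong (λ x → onePS m - x) (mono≐shift e m)) ⟩
  f · (onePS ⊕ ⊖ shift e onePS)        ≈⟨ ·-distribˡ f onePS (⊖ shift e onePS) ⟩
  f · onePS ⊕ f · (⊖ shift e onePS)    ≈⟨ (λ n → cong₂ _+_ (·-identityʳ f n) (·-negʳ f (shift e onePS) n)) ⟩
  f ⊕ ⊖ (f · shift e onePS)            ≈⟨ (λ n → cong (λ x → f n + - x)
                                             (trans (·-shiftʳ e f onePS n) (shift-cong e (·-identityʳ f) n))) ⟩
  f ⊕ ⊖ shift e f                      ∎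
  where open SetoidReasoning ≐-setoid

Σₚ : ℕ → (ℕ → PS) → PS
Σₚ m F n = sumUpTo m (λ a → F a n)

shift-Σₚ : ∀ e m F → shift e (Σₚ m F) ≐ Σₚ m (λ a → shift e (F a))
shift-Σₚ e zero    F n = shift-𝟘 e n
shift-Σₚ e (suc m) F n =
  trans (shift-⊕ e (F 0) (Σₚ m (F ∘ suc)) n) (cong (shift e (F 0) n +_) (shift-Σₚ e m (F ∘ suc) n))

Σₚ-cong : ∀ m {M F G} → (∀ a → F a ≈[ M ] G a) → Σₚ m F ≈[ M ] Σₚ m G
Σₚ-cong m eq j p = sumUpTo-cong m (λ a → eq a j p)

Σₚ-·ʳ : ∀ m F g → Σₚ m (λ a → F a · g) ≐ Σₚ m F · g
Σₚ-·ʳ zero    F g n = sym (·-zeroˡ g n)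
Σₚ-·ʳ (suc m) F g n =
  trans (cong ((F 0 · g) n +_) (Σₚ-·ʳ m (F ∘ suc) g n)) (sym (·-distribʳ (F 0) (Σₚ m (F ∘ suc)) g n))

Σₚ-·ˡ : ∀ m f F → Σₚ m (λ a → f · F a) ≐ f · Σₚ m F
Σₚ-·ˡ m f F n =
  trans (sumUpTo-cong m (λ a → ·-comm f (F a) n)) (trans (Σₚ-·ʳ m F f n) (·-comm (Σₚ m F) f n))

-- Euler's identity  Σ_{a ≥ 0} q^{a(b+1)} / (q)_a = (q)_b / (q)_∞ ,
-- proved up to degree M for the partial sum over a ≤ M.

poch-constOne : ∀ a → ConstOne (poch a)
poch-constOne zero    = refl
poch-constOne (suc a) = ·-constOne (poch a) (1-q^ (suc a)) (poch-constOne a) refl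

invPoch : ℕ → PS
invPoch a = inv (poch a)

invPoch-step : ∀ a → invPoch a ≐ invPoch (suc a) · 1-q^ (suc a)
invPoch-step a n = sym (cancel-factor n)
  where
  open SetoidReasoning ≐-setoid
  u = 1-q^ (suc a)
  cancel-factor : invPoch (suc a) · u ≐ invPoch a
  cancel-factor = begin
    invPoch (suc a) · u          ≈⟨ ·-congˡ-≐ u (inv-· (poch a) u (poch-constOne a) refl) ⟩
    (invPoch a · inv u) · u      ≈⟨ ·-assoc (invPoch a) (inv u) u ⟩
    invPoch a · (inv u · u)      ≈⟨ ·-congʳ-≐ (invPoch a) (·-comm (inv u) u) ⟩
    invPoch a · (u · inv u)      ≈⟨ ·-congʳ-≐ (invPoch a) (inv-inverseʳ u refl) ⟩
    invPoch a · onePS            ≈⟨ ·-identityʳ (invPoch a) ⟩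
    invPoch a                    ∎

eulerTerm : ℕ → ℕ → PS
eulerTerm b a = shift (a ℕ.* suc b) (invPoch a)

eulerSum : ℕ → ℕ → PS
eulerSum b M = Σₚ (suc M) (eulerTerm b)

-- From invPoch-step:  q^{(a+1)(b+1)}/(q)_{a+1}
--   = q^{(a+1)(b+2)}/(q)_{a+1} + q^{b+1} · q^{a(b+1)}/(q)_a .
eulerTerm-step : ∀ b a → eulerTerm b (suc a) ≐ eulerTerm (suc b) (suc a) ⊕ shift (suc b) (eulerTerm b a)
eulerTerm-step b a n = sym (trans (cong₂ _+_ higher lower) (cancel Y X))
  where
  E = suc a ℕ.* suc b
  P = invPoch (suc a)
  X = shift E (shift (suc a) P) n
  Y = shift E P n
  higher : eulerTerm (suc b) (suc a) n ≡ X
  higher = trans (cong (λ e → shift e P n) (trans (ℕP.*-suc (suc a) (suc b)) (ℕP.+-comm (suc a) E)))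
                 (shift-+ E (suc a) P n)
  lower : shift (suc b) (eulerTerm b a) n ≡ Y + - X
  lower = trans (sym (shift-+ (suc b) (a ℕ.* suc b) (invPoch a) n))
          (trans (shift-cong E (invPoch-step a) n)
          (trans (shift-cong E (·-1-q^ (suc a) P) n)
          (trans (shift-⊕ E P (⊖ shift (suc a) P) n)
                 (cong (Y +_) (shift-⊖ E (shift (suc a) P) n)))))
  cancel : ∀ y x → x + (y + - x) ≡ y
  cancel = solve-∀

eulerSum-step : ∀ b M → eulerSum b (suc M) ≐ eulerSum (suc b) (suc M) ⊕ shift (suc b) (eulerSum b M)
eulerSum-step b M n =
  trans (cong (eulerTerm b 0 n +_)
          (trans (sumUpTo-cong (suc M) (λ a → eulerTerm-step b a n))
                 (sumUpTo-+ (suc M) (λ a → eulerTerm (suc b) (suc a) n)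
                                    (λ a → shift (suc b) (eulerTerm b a) n))))
  (trans (sym (ℤP.+-assoc (eulerTerm b 0 n) _ _))
         (cong (eulerSum (suc b) (suc M) n +_) (sym (shift-Σₚ (suc b) (suc M) (eulerTerm b) n))))

-- The new summand q^{(M+1)(b+1)}/(q)_{M+1} does not contribute below degree M+1.
eulerSum-stable : ∀ b M → eulerSum b (suc M) ≈[ M ] eulerSum b M
eulerSum-stable b M j p =
  trans (sumUpTo-snoc (suc M) (λ a → eulerTerm b a j))
  (trans (cong (eulerSum b M j +_) (shift-vanish (suc M ℕ.* suc b) (invPoch (suc M)) j (s≤s j≤b+M·b)))
         (ℤP.+-identityʳ _))
  where
  j≤b+M·b : j ≤ b ℕ.+ M ℕ.* suc b
  j≤b+M·b = ℕP.≤-trans p (ℕP.≤-trans (ℕP.m≤m*n M (suc b)) (ℕP.m≤n+m (M ℕ.* suc b) b))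

eulerSum-suc : ∀ b M → eulerSum (suc b) M ≈[ M ] eulerSum b M · 1-q^ (suc b)
eulerSum-suc b M j p =
  trans (sym (eulerSum-stable (suc b) M j p))
  (trans (isolate (eulerSum-step b M j))
  (trans (cong (_+ - shift (suc b) (eulerSum b M) j) (eulerSum-stable b M j p))
         (sym (·-1-q^ (suc b) (eulerSum b M) j))))
  where
  isolate : ∀ {x y z} → x ≡ y + z → y ≡ x + - z
  isolate {x} {y} {z} e = trans (sym (y+z-z y z)) (cong (_+ - z) (sym e))
    where
    y+z-z : ∀ y z → y + z + - z ≡ y
    y+z-z = solve-∀

eulerSum-poch : ∀ b M → eulerSum b M ≈[ M ] eulerSum 0 M · poch b
eulerSum-poch zero    M = exact (λ n → sym (·-identityʳ (eulerSum 0 M) n))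
eulerSum-poch (suc b) M = begin
  eulerSum (suc b) M                        ≈⟨ eulerSum-suc b M ⟩
  eulerSum b M · 1-q^ (suc b)               ≈⟨ ·-congˡ (1-q^ (suc b)) (eulerSum-poch b M) ⟩
  (eulerSum 0 M · poch b) · 1-q^ (suc b)    ≈⟨ exact (·-assoc (eulerSum 0 M) (poch b) (1-q^ (suc b))) ⟩
  eulerSum 0 M · poch (suc b)               ∎
  where open SetoidReasoning (≈-setoid M)

-- For b = M only the summand a = 0 is visible below degree M + 1.
eulerSum-diagonal : ∀ M → eulerSum M M ≈[ M ] onePS
eulerSum-diagonal M j p =
  trans (cong₂ _+_ (inv-one j)
          (trans (sumUpTo-cong M (λ a → shift-vanish (suc a ℕ.* suc M) (invPoch (suc a)) j
                                                      (j<[a+1][M+1] a)))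
                 (sumUpTo-0 M)))
        (ℤP.+-identityʳ _)
  where
  j<[a+1][M+1] : ∀ a → j < suc a ℕ.* suc M
  j<[a+1][M+1] a = ℕP.≤-trans (s≤s p) (ℕP.m≤m+n (suc M) (a ℕ.* suc M))

poch-stable : ∀ d m → poch (d ℕ.+ m) ≈[ m ] poch m
poch-stable zero    m j p = refl
poch-stable (suc d) m j p =
  trans (·-1-q^ (suc (d ℕ.+ m)) (poch (d ℕ.+ m)) j)
  (trans (cong (λ z → poch (d ℕ.+ m) j + - z)
               (shift-vanish (suc (d ℕ.+ m)) (poch (d ℕ.+ m)) j (s≤s (ℕP.≤-trans p (ℕP.m≤n+m m d)))))
  (trans (ℤP.+-identityʳ _) (poch-stable d m j p)))

qinf≈poch : ∀ M → qinf ≈[ M ] poch M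
qinf≈poch M j p =
  trans (sym (poch-stable (M ∸ j) j j ℕP.≤-refl)) (cong (λ x → poch x j) (ℕP.m∸n+n≡m p))

invQinf : PS
invQinf = inv qinf

-- b = 0:  Σ_{a ≤ M} q^a / (q)_a ≡ 1 / (q)_∞ ,
-- since  (q)_∞ · eulerSum 0 M ≡ eulerSum 0 M · (q)_M ≡ eulerSum M M ≡ 1.
eulerSum-zero : ∀ M → eulerSum 0 M ≈[ M ] invQinf
eulerSum-zero M = inv-unique qinf (eulerSum 0 M) refl (begin
  qinf · eulerSum 0 M          ≈⟨ ·-congˡ (eulerSum 0 M) (qinf≈poch M) ⟩
  poch M · eulerSum 0 M        ≈⟨ exact (·-comm (poch M) (eulerSum 0 M)) ⟩
  eulerSum 0 M · poch M        ≈⟨ ≈-sym (eulerSum-poch M M) ⟩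
  eulerSum M M                 ≈⟨ eulerSum-diagonal M ⟩
  onePS                        ∎)
  where open SetoidReasoning (≈-setoid M)

euler : ∀ b M → eulerSum b M ≈[ M ] invQinf · poch b
euler b M = begin
  eulerSum b M               ≈⟨ eulerSum-poch b M ⟩
  eulerSum 0 M · poch b      ≈⟨ ·-congˡ (poch b) (eulerSum-zero M) ⟩
  invQinf · poch b          ∎
  where open SetoidReasoning (≈-setoid M)

geometricSum : ℕ → PS
geometricSum M = Σₚ (suc M) (λ b → shift b onePS)

geometricSum-coeff : ∀ n M → n ≤ M → geometricSum M n ≡ 1ℤ
geometricSum-coeff zero    M       p       = cong (1ℤ +_) (sumUpTo-0 M)
geometricSum-coeff (suc n) (suc M) (s≤s p) =
  trans (ℤP.+-identityˡ _)
        (trans (sumUpTo-cong (suc M) (λ b → shift-at-suc b onePS n)) (geometricSum-coeff n M p))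

geometric : ∀ M → geometricSum M ≈[ M ] inv (1-q^ 1)
geometric M = inv-unique (1-q^ 1) (geometricSum M) refl (begin
  1-q^ 1 · geometricSum M       ≈⟨ ·-congʳ (1-q^ 1) (λ j p → geometricSum-coeff j M p) ⟩
  1-q^ 1 · ones                 ≈⟨ exact (·-comm (1-q^ 1) ones) ⟩
  ones · 1-q^ 1                 ≈⟨ exact (·-1-q^ 1 ones) ⟩
  ones ⊕ ⊖ shift 1 ones         ≈⟨ exact telescope ⟩
  onePS                         ∎)
  where
  open SetoidReasoning (≈-setoid M)
  ones : PS
  ones _ = 1ℤ
  telescope : ones ⊕ ⊖ shift 1 ones ≐ onePS
  telescope zero    = refl
  telescope (suc n) = refl

denom : List ℕ → PS
denom ns = prodPS (denomFactors ns)

-- The part of the denominator of  term (a ∷ b ∷ s)  left after removing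
-- one factor (q)_a and one factor (q)_b.
restDenom : ℕ → List ℕ → PS
restDenom b []      = onePS
restDenom b (c ∷ s) = denom (b ∷ c ∷ s)

denom-cons : ∀ a b s → denom (a ∷ b ∷ s) ≡ poch a · (poch b · restDenom b s)
denom-cons a b []      = refl
denom-cons a b (c ∷ s) = refl

restDenom-constOne : ∀ b s → ConstOne (restDenom b s)
restDenom-constOne b []      = refl
restDenom-constOne b (c ∷ s) = subst ConstOne (sym (denom-cons b c s)) (
  ·-constOne (poch b) (poch c · restDenom c s) (poch-constOne b)
    (·-constOne (poch c) (restDenom c s) (poch-constOne c) (restDenom-constOne c s)))

exponent-cons : ∀ a b s → exponent (a ∷ b ∷ s) ≡ a ℕ.* suc b ℕ.+ exponent (b ∷ s)
exponent-cons a b s = regroup a b (sumℕ (b ∷ s)) (adjSum (b ∷ s))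
  where
  regroup : ∀ a b x y → (a ℕ.+ x) ℕ.+ (a ℕ.* b ℕ.+ y) ≡ a ℕ.* suc b ℕ.+ (x ℕ.+ y)
  regroup = ℕSolver.solve-∀

-- term (a ∷ b ∷ s) with the factor q^{a(b+1)}/(q)_a taken out; its
-- denominator has one factor (q)_b more than that of term (b ∷ s).
afterFirst : ℕ → List ℕ → PS
afterFirst b s = shift (exponent (b ∷ s)) (inv (poch b · restDenom b s))

term-cons : ∀ a b s → term (a ∷ b ∷ s) ≐ eulerTerm b a · afterFirst b s
term-cons a b s n =
  trans (cong₂ (λ e D → shift e (inv D) n) (exponent-cons a b s) (denom-cons a b s))
        (shift-inv-· (a ℕ.* suc b) (exponent (b ∷ s)) (poch a) (poch b · restDenom b s)
           (poch-constOne a) (·-constOne (poch b) (restDenom b s) (poch-constOne b) (restDenom-constOne b s)) n)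

sumFirst : ℕ → (List ℕ → PS) → List ℕ → PS
sumFirst M F ns = Σₚ (suc M) (λ a → F (a ∷ ns))

-- Summing out the first index with Euler's identity:
--   Σ_a term (a ∷ b ∷ s) = (q)_b · afterFirst b s / (q)_∞ ,
-- and (q)_b cancels one of the two factors (q)_b in afterFirst.
sumOutFirst : ∀ M b s → sumFirst M term (b ∷ s) ≈[ M ]
                        invQinf · shift (exponent (b ∷ s)) (inv (restDenom b s))
sumOutFirst M b s = begin
  sumFirst M term (b ∷ s)                  ≈⟨ exact (λ n → sumUpTo-cong (suc M) (λ a → term-cons a b s n)) ⟩
  Σₚ (suc M) (λ a → eulerTerm b a · R)     ≈⟨ exact (Σₚ-·ʳ (suc M) (eulerTerm b) R) ⟩
  eulerSum b M · R                         ≈⟨ ·-congˡ R (euler b M) ⟩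
  (invQinf · poch b) · R                   ≈⟨ exact (·-assoc invQinf (poch b) R) ⟩
  invQinf · (poch b · R)                   ≈⟨ exact (·-congʳ-≐ invQinf cancel-poch) ⟩
  invQinf · shift e (inv (restDenom b s))  ∎
  where
  open SetoidReasoning (≈-setoid M)
  e = exponent (b ∷ s)
  R = afterFirst b s
  cancel-poch : poch b · R ≐ shift e (inv (restDenom b s))
  cancel-poch n =
    trans (·-shiftʳ e (poch b) (inv (poch b · restDenom b s)) n)
          (shift-cong e (·-inv-cancel (poch b) (restDenom b s)
                                       (poch-constOne b) (restDenom-constOne b s)) n)

sumOutFirst-end : ∀ M b → sumFirst M term (b ∷ []) ≈[ M ] invQinf · shift b onePS
sumOutFirst-end M b j p =
  trans (sumOutFirst M b [] j p) (·-congʳ-≐ invQinf q^b/1≐q^b j)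
  where
  q^b/1≐q^b : shift (b ℕ.+ 0 ℕ.+ 0) (inv onePS) ≐ shift b onePS
  q^b/1≐q^b n = trans (cong (λ e → shift e (inv onePS) n) b+0+0≡b) (shift-cong b inv-one n)
    where
    b+0+0≡b : b ℕ.+ 0 ℕ.+ 0 ≡ b
    b+0+0≡b = trans (ℕP.+-identityʳ (b ℕ.+ 0)) (ℕP.+-identityʳ b)

sumOutFirst-interior : ∀ M b c s → sumFirst M term (b ∷ c ∷ s) ≈[ M ] invQinf · term (b ∷ c ∷ s)
sumOutFirst-interior M b c s = sumOutFirst M b (c ∷ s)

-- Sums over tuples (n₁,…,n_k) with all n_i ≤ M;  lhs k N = tupleSum k N term N.

tupleSum : ℕ → ℕ → (List ℕ → PS) → PS
tupleSum k M F n = sumℤ (map (λ ns → F ns n) (tuples M k))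

tupleSum-cons : ∀ k M F → tupleSum (suc k) M F ≐ Σₚ (suc M) (λ a → tupleSum k M (F ∘ (a ∷_)))
tupleSum-cons k M F n =
  trans (sumList-concatMap (λ ns → F ns n) (λ a → map (a ∷_) (tuples M k)) (upTo (suc M)))
  (trans (sumList-cong (upTo (suc M)) (λ a → cong sumℤ (sym (map-∘ (tuples M k)))))
         (sum-applyUpTo (λ a → tupleSum k M (F ∘ (a ∷_)) n) id (suc M)))

tupleSum-first : ∀ k M F → tupleSum (suc k) M F ≐ tupleSum k M (sumFirst M F)
tupleSum-first k M F n =
  trans (tupleSum-cons k M F n) (sumUpTo-sumList (suc M) (tuples M k) (λ a ns → F (a ∷ ns) n))

tupleSum-one : ∀ M F → tupleSum 1 M F ≐ Σₚ (suc M) (λ b → F (b ∷ []))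
tupleSum-one M F n =
  trans (tupleSum-cons 0 M F n) (sumUpTo-cong (suc M) (λ b → ℤP.+-identityʳ (F (b ∷ []) n)))

tupleSum-cong₂ : ∀ k M {F G} → (∀ b c s → F (b ∷ c ∷ s) ≈[ M ] G (b ∷ c ∷ s)) →
                 tupleSum (2 ℕ.+ k) M F ≈[ M ] tupleSum (2 ℕ.+ k) M G
tupleSum-cong₂ k M {F} {G} eq j p =
  trans (tupleSum-cons (suc k) M F j)
  (trans (sumUpTo-cong (suc M) (λ b →
           trans (tupleSum-cons k M (F ∘ (b ∷_)) j)
           (trans (sumUpTo-cong (suc M) (λ c → sumList-cong (tuples M k) (λ s → eq b c s j p)))
                  (sym (tupleSum-cons k M (G ∘ (b ∷_)) j)))))
         (sym (tupleSum-cons (suc k) M G j)))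

tupleSum-·ˡ : ∀ k M f F → tupleSum k M (λ ns → f · F ns) ≐ f · tupleSum k M F
tupleSum-·ˡ k M f F n = sym (distribute (tuples M k) n)
  where
  listSum : List (List ℕ) → PS
  listSum L m = sumℤ (map (λ ns → F ns m) L)
  distribute : ∀ L → f · listSum L ≐ (λ m → sumℤ (map (λ ns → (f · F ns) m) L))
  distribute []      m = ·-zeroʳ f m
  distribute (x ∷ L) m =
    trans (·-distribˡ f (F x) (listSum L) m) (cong ((f · F x) m +_) (distribute L m))

rhs-one : inv (1-q^ 1) ≐ rhs 1
rhs-one = inv-cong refl (λ n → sym (·-identityʳ (1-q^ 1) n))

powPS-constOne : ∀ f m → ConstOne f → ConstOne (powPS f m)
powPS-constOne f zero    f0 = refl
powPS-constOne f (suc m) f0 = ·-constOne f (powPS f m) f0 (powPS-constOne f m f0)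

rhs-suc : ∀ k → invQinf · rhs (suc k) ≐ rhs (suc (suc k))
rhs-suc k = begin
  invQinf · inv (u · Q)      ≈⟨ (λ n → sym (inv-· qinf (u · Q) refl uQ-constOne n)) ⟩
  inv (qinf · (u · Q))       ≈⟨ inv-cong (·-constOne qinf (u · Q) refl uQ-constOne) reorder ⟩
  inv (u · (qinf · Q))       ∎
  where
  open SetoidReasoning ≐-setoid
  u = 1-q^ 1
  Q = powPS qinf k
  uQ-constOne : ConstOne (u · Q)
  uQ-constOne = ·-constOne u Q refl (powPS-constOne qinf k refl)
  reorder : qinf · (u · Q) ≐ u · (qinf · Q)
  reorder m = trans (sym (·-assoc qinf u Q m))
                    (trans (·-congˡ-≐ Q (·-comm qinf u) m) (·-assoc u qinf Q m))

lhs-two : ∀ M → tupleSum 2 M term ≈[ M ] rhs 2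
lhs-two M = begin
  tupleSum 2 M term                                ≈⟨ exact (tupleSum-first 1 M term) ⟩
  tupleSum 1 M (sumFirst M term)                   ≈⟨ exact (tupleSum-one M (sumFirst M term)) ⟩
  Σₚ (suc M) (λ b → sumFirst M term (b ∷ []))      ≈⟨ Σₚ-cong (suc M) (sumOutFirst-end M) ⟩
  Σₚ (suc M) (λ b → invQinf · shift b onePS)       ≈⟨ exact (Σₚ-·ˡ (suc M) invQinf (λ b → shift b onePS)) ⟩
  invQinf · geometricSum M                         ≈⟨ ·-congʳ invQinf (geometric M) ⟩
  invQinf · inv (1-q^ 1)                           ≈⟨ exact (·-congʳ-≐ invQinf rhs-one) ⟩
  invQinf · rhs 1                                  ≈⟨ exact (rhs-suc 0) ⟩
  rhs 2                                            ∎
  where open SetoidReasoning (≈-setoid M)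

lhs-suc : ∀ k M → tupleSum (3 ℕ.+ k) M term ≈[ M ] invQinf · tupleSum (2 ℕ.+ k) M term
lhs-suc k M = begin
  tupleSum (3 ℕ.+ k) M term                       ≈⟨ exact (tupleSum-first (2 ℕ.+ k) M term) ⟩
  tupleSum (2 ℕ.+ k) M (sumFirst M term)          ≈⟨ tupleSum-cong₂ k M (sumOutFirst-interior M) ⟩
  tupleSum (2 ℕ.+ k) M (λ ns → invQinf · term ns) ≈⟨ exact (tupleSum-·ˡ (2 ℕ.+ k) M invQinf term) ⟩
  invQinf · tupleSum (2 ℕ.+ k) M term             ∎
  where open SetoidReasoning (≈-setoid M)

lhs≈rhs : ∀ k M → tupleSum (2 ℕ.+ k) M term ≈[ M ] rhs (2 ℕ.+ k)
lhs≈rhs zero    M = lhs-two M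
lhs≈rhs (suc k) M = begin
  tupleSum (3 ℕ.+ k) M term             ≈⟨ lhs-suc k M ⟩
  invQinf · tupleSum (2 ℕ.+ k) M term   ≈⟨ ·-congʳ invQinf (lhs≈rhs k M) ⟩
  invQinf · rhs (2 ℕ.+ k)               ≈⟨ exact (rhs-suc (suc k)) ⟩
  rhs (3 ℕ.+ k)                         ∎
  where open SetoidReasoning (≈-setoid M)

-- lhs k N  is the degree-N coefficient of the tuple sum up to N.
proposition6p2 : (k : ℕ) → 2 ≤ k → (N : ℕ) → lhs k N ≡ rhs k N
proposition6p2 (suc zero)    (s≤s ()) N
proposition6p2 (suc (suc k)) _        N = lhs≈rhs k N N ℕP.≤-refl
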